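{- Let $(\mathsf D,\Upsilon)\in\mathrm{SSPF}_{\mathbf w}(m,n)$ and $f=\mathcal A_{\mathbf w}(\mathsf D,\Upsilon)$. Then \[ \mathrm{codinv}(\mathsf D,\Upsilon)=|\{(i,j)\in\{1,\dots,m\}\times\{1,\dots,n\}:f(i+j)<f(i)\}|. \]
   Context: Fix coprime positive integers $m,n$, a positive integer $r$, $\mathbf w=(w_1,\dots,w_r)\in\mathbb Z^r_{\ge0}$ with $\sum w_i=m$. An $(m,n)$-Dyck path $\mathsf D$ is a lattice path from $(0,m)$ to $(n,0)$ of unit south and east steps staying weakly below $mx+ny=mn$; vertical steps $v_0,\dots,v_{m-1}$ (top to bottom) with top endpoints $(a_j,m-j)$, identified with $v_j$; consecutive if $a_j=a_{j+1}$. $\gamma(x,y)=mn-mx-ny$. A rank $r$ semistandard $(m,n)$-parking function is $(\mathsf D,\Upsilon)$, $\Upsilon:\{v_j\}\to\{1,\dots,r\}$, $\Upsilon(v_j)\le\Upsilon(v_{j+1})$ for consecutive steps; weight $(|\Upsilon^{ -1}(i)|)_i$; $\mathrm{SSPF}_{\mathbf w}(m,n)$. Parking functions $(\mathsf D,\varphi)$: $\varphi$ bijective onto $\{1,\dots,m\}$, strictly increasing on consecutive steps; set $\mathrm{PF}_{m,n}$. $(m,r)$-affine composition: $f:\mathbb Z\to\mathbb Z$, $f(x+m)=f(x)+r$, $f^{ -1}([1,r])$ of size $m$, distinct mod $m$, sum $m(m+1)/2$. $\widetilde S_m$: bijections with $\sigma(x+m)=\sigma(x)+m$, $\sum_{i=1}^m\sigma(i)=m(m+1)/2$.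 $\mathcal A_{\mathbf w}(\mathsf D,\Upsilon)(x)=\tilde f(x+k)$ where $\tilde f(\gamma(v_j)+pm)=\Upsilon(v_j)+pr$ ($p\in\mathbb Z$) and $\sum_j(\gamma(v_j)-(j+1))=km$; $\mathcal A=\mathcal A_{(1^m)}$ is a bijection from $\mathrm{PF}_{m,n}$ to $n$-stable elements of $\widetilde S_m$. $f_{\mathbf w}(x)=i$ for $w_1+\dots+w_{i-1}<x\le w_1+\dots+w_i$, $f_{\mathbf w}(x+m)=f_{\mathbf w}(x)+r$. For $f$ of weight $\mathbf w$ there is a unique $\sigma\in\widetilde S_m$ with $f=f_{\mathbf w}\circ\sigma$ and $\sigma^{ -1}(a)<\sigma^{ -1}(b)$ whenever $a<b$, $f_{\mathbf w}(a)=f_{\mathbf w}(b)$; $\mathrm{std}(\mathsf D,\Upsilon)=\mathcal A^{ -1}(\sigma)$ for $f=\mathcal A_{\mathbf w}(\mathsf D,\Upsilon)$. For $(\mathsf D,\varphi)\in\mathrm{PF}_{m,n}$ with $\omega=\mathcal A(\mathsf D,\varphi)$, $\mathrm{codinv}(\mathsf D,\varphi)=|\{(i,h)\in\{1,\dots,m\}\times\{1,\dots,n\}:\omega(i+h)<\omega(i)\}|$, and $\mathrm{codinv}(\mathsf D,\Upsilon):=\mathrm{codinv}(\mathrm{std}(\mathsf D,\Upsilon))$. -}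

module Defs where

open import Data.Nat as ℕ using (ℕ; zero; suc; _≤_; _<_)
open import Data.Nat.DivMod using (_/_)
open import Data.Integer as ℤ using (ℤ; +_)
open import Data.Integer.Properties using () renaming (_<?_ to _<ℤ?_)
open import Data.Fin as Fin using (Fin; toℕ)
open import Data.Vec as Vec using (Vec; []; _∷_; lookup)
open import Data.List as List using (List; length; filter; map; upTo; allFin; foldr)
open import Data.Product using (Σ; _×_; ∃)
open import Relation.Binary.PropositionalEquality using (_≡_)
open import Function.Definitions using (Bijective)
open import Relation.Nullary.Decidable using (⌊_⌋)
open import Data.Nat.ListAction using () renaming (sum to sumℕ)

-- An (m,n)-Dyck path, encoded by the x-coordinates a_j of the top endpoints
-- (a_j , m - j) of its vertical steps v_0,...,v_{m-1} (top to bottom).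
-- The path goes from (0,m) to (n,0) by unit S/E steps; it stays weakly below
-- mx + ny = mn  iff  m * a_j ≤ n * j for every j (the worst point of row m-j
-- is the top of v_j); the a_j weakly increase.
record DyckPath (m n : ℕ) : Set where
  field
    a     : Fin m → ℕ
    mono  : ∀ (j j' : Fin m) → toℕ j' ≡ suc (toℕ j) → a j ≤ a j'
    below : ∀ (j : Fin m) → m ℕ.* a j ≤ n ℕ.* toℕ j
open DyckPath public

-- γ(v_j) = mn - m a_j - n (m - j) = n j - m a_j
γ : ∀ {m n} → DyckPath m n → Fin m → ℤ
γ {m} {n} D j = + (n ℕ.* toℕ j) ℤ.- + (m ℕ.* a D j)

-- Labels: Υ j : Fin r stands for the colour (toℕ (Υ j) + 1) ∈ {1,…,r}.
colour : ∀ {r} → Fin r → ℤ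
colour i = + suc (toℕ i)

IsSSPF : ∀ {m n r} → DyckPath m n → (Fin m → Fin r) → Set
IsSSPF {m} D Υ = ∀ (j j' : Fin m) → toℕ j' ≡ suc (toℕ j) → a D j ≡ a D j' →
                 Υ j Fin.≤ Υ j'

HasWeight : ∀ {m r} → Vec ℕ r → (Fin m → Fin r) → Set
HasWeight {m} {r} w Υ = ∀ (i : Fin r) →
  length (filter (λ j → Υ j Fin.≟ i) (allFin m)) ≡ lookup w i

sumℤ : List ℤ → ℤ
sumℤ = foldr ℤ._+_ (+ 0)

-- f = A_w(D,Υ):  f(x) = f̃(x+k), where f̃(γ(v_j)+pm) = Υ(v_j) + pr and
-- Σ_j (γ(v_j) - (j+1)) = k m.  Stated as the defining equations of f.
IsAw : ∀ {m n r} → DyckPath m n → (Fin m → Fin r) → (ℤ → ℤ) → Set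
IsAw {m} {n} {r} D Υ f =
  Σ ℤ λ k →
    (sumℤ (map (λ j → γ D j ℤ.- + suc (toℕ j)) (allFin m)) ≡ k ℤ.* + m)
    × (∀ (j : Fin m) (p : ℤ) →
         f (γ D j ℤ.+ p ℤ.* + m ℤ.- k) ≡ colour (Υ j) ℤ.+ p ℤ.* + r)

psum : ∀ {r} → Vec ℕ r → ℕ → ℕ
psum _ zero = 0
psum [] (suc i) = 0
psum (x ∷ xs) (suc i) = x ℕ.+ psum xs i

IsFw : ∀ {r} → (m : ℕ) → Vec ℕ r → (ℤ → ℤ) → Set
IsFw {r} m w g = ∀ (i : Fin r) (t : ℕ) (p : ℤ) →
  psum w (toℕ i) < t → t ≤ psum w (suc (toℕ i)) →
  g (+ t ℤ.+ p ℤ.* + m) ≡ colour i ℤ.+ p ℤ.* + r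

range1 : ℕ → List ℕ
range1 k = map suc (upTo k)

IsAffinePerm : ℕ → (ℤ → ℤ) → Set
IsAffinePerm m σ =
  Bijective _≡_ _≡_ σ
  × (∀ x → σ (x ℤ.+ + m) ≡ σ x ℤ.+ + m)
  × (sumℤ (map (λ i → σ (+ i)) (range1 m)) ≡ + (m ℕ.* suc m / 2))

-- σ⁻¹(a) < σ⁻¹(b) whenever a < b and f_w(a) = f_w(b)  (with a = σ x, b = σ y)
OrderCond : (ℤ → ℤ) → (ℤ → ℤ) → Set
OrderCond g σ = ∀ x y → σ x ℤ.< σ y → g (σ x) ≡ g (σ y) → x ℤ.< y

pairCount : ℕ → ℕ → (ℤ → ℤ) → ℕ
pairCount m n φ = sumℕ (map (λ i →
  length (filter (λ h → φ (+ i ℤ.+ + h) <ℤ? φ (+ i)) (range1 n))) (range1 m))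

-- codinv of a parking function with ω = A(D,φ): pairCount m n ω.
-- codinv(D,Υ) := codinv(std(D,Υ)) = codinv(A⁻¹(σ)) = pairCount m n σ,
-- where σ is the standardization permutation of f = A_w(D,Υ).
codinvStd : ℕ → ℕ → (ℤ → ℤ) → ℕ
codinvStd m n σ = pairCount m n σ

{-# OPTIONS --safe #-}
-- f_w is weakly increasing on ℤ: it climbs through the colours 1,…,r on each
-- period of length m, and the next period starts r higher.  Standardization
-- only breaks the ties of f_w, so for x ≤ y a descent σ(y) < σ(x) is a weak
-- descent of f = f_w ∘ σ, and a tie f(y) = f(x) is ruled out by the order
-- condition, which would force y < x.  Hence σ and f have the same descents.
module Submission where

open import Defs
open import Data.Nat using (ℕ; _<_)
open import Data.Nat.Coprimality using (Coprime)
open import Data.Integer using (ℤ)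
open import Data.Fin using (Fin)
open import Data.Vec using (Vec; sum)
open import Relation.Binary.PropositionalEquality using (_≡_)

import Data.Nat as ℕ
import Data.Nat.Properties as ℕ
open import Data.Integer as ℤ using (+_; _+_; _-_; _*_; _≤_)
import Data.Integer.Properties as ℤ
open import Data.Integer.DivMod using (_%ℕ_; _/ℕ_; a≡a%ℕn+[a/ℕn]*n; n%ℕd<d)
open import Data.Integer.Tactic.RingSolver using (solve-∀)
open import Data.Fin using (toℕ; zero; suc)
open import Data.Fin.Properties using (toℕ<n)
open import Data.Vec using ([]; _∷_)
open import Data.List using (length; filter)
open import Data.Nat.ListAction using () renaming (sum to sumℕ)
open import Data.List.Properties using (map-cong; filter-≐)
open import Data.Product using (∃; _×_; _,_)
open import Function using (_∘_)
open import Relation.Nullary using (yes; no; contradiction)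
open import Relation.Binary.PropositionalEquality
  using (refl; sym; trans; cong; subst; subst₂; module ≡-Reasoning)

psum-mono : ∀ {r} (w : Vec ℕ r) {a b} → a ℕ.≤ b → psum w a ℕ.≤ psum w b
psum-mono w        {ℕ.zero}  _           = ℕ.z≤n
psum-mono []       {ℕ.suc _} (ℕ.s≤s _)   = ℕ.z≤n
psum-mono (x ∷ xs) {ℕ.suc _} (ℕ.s≤s a≤b) = ℕ.+-monoʳ-≤ x (psum-mono xs a≤b)

psum-interval : ∀ {r} (w : Vec ℕ r) t → 0 < t → t ℕ.≤ sum w →
  ∃ λ (i : Fin r) → psum w (toℕ i) < t × t ℕ.≤ psum w (ℕ.suc (toℕ i))
psum-interval []       t 0<t t≤0 = contradiction (ℕ.<-≤-trans 0<t t≤0) (ℕ.<-irrefl refl)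
psum-interval (x ∷ xs) t 0<t t≤sum with t ℕ.≤? x
... | yes t≤x = zero , 0<t , ℕ.≤-trans t≤x (ℕ.m≤m+n x _)
... | no  t≰x = shift (psum-interval xs (t ℕ.∸ x) (ℕ.m<n⇒0<n∸m x<t) t∸x≤sum)
  where
  x<t = ℕ.≰⇒> t≰x
  x+[t∸x]≡t : x ℕ.+ (t ℕ.∸ x) ≡ t
  x+[t∸x]≡t = ℕ.m+[n∸m]≡n (ℕ.<⇒≤ x<t)
  t∸x≤sum : t ℕ.∸ x ℕ.≤ sum xs
  t∸x≤sum = ℕ.+-cancelˡ-≤ x _ _ (subst (ℕ._≤ x ℕ.+ sum xs) (sym x+[t∸x]≡t) t≤sum)
  shift : ∃ (λ i → psum xs (toℕ i) < t ℕ.∸ x × t ℕ.∸ x ℕ.≤ psum xs (ℕ.suc (toℕ i))) →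
          ∃ (λ i → psum (x ∷ xs) (toℕ i) < t × t ℕ.≤ psum (x ∷ xs) (ℕ.suc (toℕ i)))
  shift (i , lower , upper) = suc i ,
    subst (x ℕ.+ psum xs (toℕ i) <_) x+[t∸x]≡t (ℕ.+-monoʳ-< x lower) ,
    subst (ℕ._≤ x ℕ.+ psum xs (ℕ.suc (toℕ i))) x+[t∸x]≡t (ℕ.+-monoʳ-≤ x upper)

psum-interval-mono : ∀ {r} (w : Vec ℕ r) {t t'} (i i' : Fin r) →
  psum w (toℕ i) < t → t' ℕ.≤ psum w (ℕ.suc (toℕ i')) → t ℕ.≤ t' → toℕ i ℕ.≤ toℕ i'
psum-interval-mono w {t} {t'} i i' lower upper t≤t' with toℕ i ℕ.≤? toℕ i'
... | yes i≤i' = i≤i'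
... | no  i≰i' = contradiction (ℕ.<-≤-trans lower t≤t')
  (ℕ.≤⇒≯ (ℕ.≤-trans upper (psum-mono w (ℕ.≰⇒> i≰i'))))

colour-≤ : ∀ {r} (i : Fin r) → colour i ≤ + r
colour-≤ i = ℤ.+≤+ (toℕ<n i)

step⇒monotone : (g : ℤ → ℤ) → (∀ x → g x ≤ g (x + + 1)) → ∀ {a b} → a ≤ b → g a ≤ g b
step⇒monotone g step {a} {b} a≤b = subst (λ c → g a ≤ g c) a+[b-a]≡b (go ℤ.∣ b - a ∣)
  where
  go : ∀ k → g a ≤ g (a + + k)
  go ℕ.zero    = ℤ.≤-reflexive (cong g (sym (ℤ.+-identityʳ a)))
  go (ℕ.suc k) = ℤ.≤-trans (go k)
    (subst (λ c → g (a + + k) ≤ g c) a+k+1≡a+[1+k] (step (a + + k)))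
    where
    a+k+1≡a+[1+k] : a + + k + + 1 ≡ a + + ℕ.suc k
    a+k+1≡a+[1+k] = trans (ℤ.+-assoc a (+ k) (+ 1)) (cong (λ j → a + + j) (ℕ.+-comm k 1))
  a+[b-a]≡b : a + + ℤ.∣ b - a ∣ ≡ b
  a+[b-a]≡b = trans (cong (λ d → a + d) (ℤ.0≤i⇒+∣i∣≡i (ℤ.i≤j⇒0≤j-i a≤b))) (cancel a b)
    where cancel : ∀ a b → a + (b - a) ≡ b
          cancel = solve-∀

block-decomposition : ∀ m .{{_ : ℕ.NonZero m}} x →
  ∃ λ s → ∃ λ q → s < m × x ≡ + ℕ.suc s + q * + m
block-decomposition m x = s , q , n%ℕd<d (x - + 1) m , (begin
  x                     ≡⟨ x≡[x-1]+1 x ⟩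
  (x - + 1) + + 1       ≡⟨ cong (_+ + 1) (a≡a%ℕn+[a/ℕn]*n (x - + 1) m) ⟩
  (+ s + q * + m) + + 1 ≡⟨ shift (+ s) (q * + m) ⟩
  + ℕ.suc s + q * + m   ∎)
  where
  open ≡-Reasoning
  s = (x - + 1) %ℕ m
  q = (x - + 1) /ℕ m
  x≡[x-1]+1 : ∀ x → x ≡ (x - + 1) + + 1
  x≡[x-1]+1 = solve-∀
  shift : ∀ a b → (a + b) + + 1 ≡ (+ 1 + a) + b
  shift = solve-∀

module CompositionFw {r} (m : ℕ) .{{_ : ℕ.NonZero m}} (w : Vec ℕ r) (sum-w≡m : sum w ≡ m)
                     {g : ℤ → ℤ} (isFw : IsFw m w g) where

  fw-value : ∀ {t} p → 0 < t → t ℕ.≤ m →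
    ∃ λ (i : Fin r) → (psum w (toℕ i) < t × t ℕ.≤ psum w (ℕ.suc (toℕ i)))
                    × g (+ t + p * + m) ≡ colour i + p * + r
  fw-value {t} p 0<t t≤m with psum-interval w t 0<t (subst (t ℕ.≤_) (sym sum-w≡m) t≤m)
  ... | i , lower , upper = i , (lower , upper) , isFw i t p lower upper

  fw-step-inside-block : ∀ {s} q → ℕ.suc s < m →
    g (+ ℕ.suc s + q * + m) ≤ g (+ ℕ.suc (ℕ.suc s) + q * + m)
  fw-step-inside-block {s} q 1+s<m
    with i  , (lower , _) , gx  ← fw-value q ℕ.z<s (ℕ.<⇒≤ 1+s<m)
       | i' , (_ , upper) , gx' ← fw-value q ℕ.z<s 1+s<m
    = begin
    g (+ ℕ.suc s + q * + m)          ≡⟨ gx ⟩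
    colour i + q * + r               ≤⟨ ℤ.+-monoˡ-≤ (q * + r) (ℤ.+≤+ (ℕ.s≤s i≤i')) ⟩
    colour i' + q * + r              ≡⟨ gx' ⟨
    g (+ ℕ.suc (ℕ.suc s) + q * + m)  ∎
    where
    open ℤ.≤-Reasoning
    i≤i' = psum-interval-mono w i i' lower upper (ℕ.n≤1+n _)

  fw-step-across-blocks : ∀ q → g (+ m + q * + m) ≤ g (+ m + q * + m + + 1)
  fw-step-across-blocks q
    with i  , _ , gx  ← fw-value q (ℕ.>-nonZero⁻¹ m) ℕ.≤-refl
       | i' , _ , gx' ← fw-value (q + + 1) ℕ.z<s (ℕ.>-nonZero⁻¹ m)
    = begin
    g (+ m + q * + m)                ≡⟨ gx ⟩
    colour i + q * + r               ≤⟨ ℤ.+-monoˡ-≤ (q * + r) (colour-≤ i) ⟩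
    + r + q * + r                    ≡⟨ end-of-block (+ r) q ⟩
    + 0 + (q + + 1) * + r            ≤⟨ ℤ.+-monoˡ-≤ ((q + + 1) * + r) (ℤ.+≤+ ℕ.z≤n) ⟩
    colour i' + (q + + 1) * + r      ≡⟨ gx' ⟨
    g (+ 1 + (q + + 1) * + m)        ≡⟨ cong g (start-of-next-block (+ m) q) ⟩
    g (+ m + q * + m + + 1)          ∎
    where
    open ℤ.≤-Reasoning
    end-of-block : ∀ R q → R + q * R ≡ + 0 + (q + + 1) * R
    end-of-block = solve-∀
    start-of-next-block : ∀ M q → + 1 + (q + + 1) * M ≡ M + q * M + + 1
    start-of-next-block = solve-∀

  fw-step : ∀ x → g x ≤ g (x + + 1)
  fw-step x with block-decomposition m x
  ... | s , q , s<m , refl with ℕ.suc s ℕ.<? m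
  ... | yes 1+s<m = subst (λ y → g (+ ℕ.suc s + q * + m) ≤ g y)
                          (successor (+ ℕ.suc s) (q * + m)) (fw-step-inside-block q 1+s<m)
    where successor : ∀ a b → + 1 + a + b ≡ a + b + + 1
          successor = solve-∀
  ... | no  1+s≮m = subst (λ t → g (+ t + q * + m) ≤ g (+ t + q * + m + + 1))
                          (ℕ.≤-antisym (ℕ.≮⇒≥ 1+s≮m) s<m) (fw-step-across-blocks q)

  fw-monotone : ∀ {a b} → a ≤ b → g a ≤ g b
  fw-monotone = step⇒monotone g fw-step

module Standardization {f g σ : ℤ → ℤ} (g-mono : ∀ {a b} → a ≤ b → g a ≤ g b)
                       (f≗g∘σ : ∀ x → f x ≡ g (σ x)) (order : OrderCond g σ) where

  descent-preserved : ∀ {x y} → x ≤ y → σ y ℤ.< σ x → f y ℤ.< f x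
  descent-preserved x≤y σy<σx = subst₂ ℤ._<_ (sym (f≗g∘σ _)) (sym (f≗g∘σ _))
    (ℤ.≤∧≢⇒< (g-mono (ℤ.<⇒≤ σy<σx)) (ℤ.≤⇒≯ x≤y ∘ order _ _ σy<σx))

  descent-reflected : ∀ {x y} → x ≤ y → f y ℤ.< f x → σ y ℤ.< σ x
  descent-reflected {x} {y} _ fy<fx with σ y ℤ.<? σ x
  ... | yes σy<σx = σy<σx
  ... | no  σy≮σx = contradiction (subst₂ ℤ._<_ (f≗g∘σ y) (f≗g∘σ x) fy<fx)
                                  (ℤ.≤⇒≯ (g-mono (ℤ.≮⇒≥ σy≮σx)))

  pairCount-std : ∀ m n → pairCount m n σ ≡ pairCount m n f
  pairCount-std m n = cong sumℕ (map-cong descents-agree (range1 m))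
    where
    i≤i+h : ∀ i h → + i ≤ + i + + h
    i≤i+h i h = ℤ.+≤+ (ℕ.m≤m+n i h)
    descents-agree : ∀ i →
      length (filter (λ h → σ (+ i + + h) ℤ.<? σ (+ i)) (range1 n)) ≡
      length (filter (λ h → f (+ i + + h) ℤ.<? f (+ i)) (range1 n))
    descents-agree i = cong length (filter-≐ _ _
      ((λ {h} → descent-preserved (i≤i+h i h)) , (λ {h} → descent-reflected (i≤i+h i h)))
      (range1 n))

mainTheorem14 : (m n r : ℕ) → 0 < m → 0 < n → 0 < r → Coprime m n →
    (w : Vec ℕ r) → sum w ≡ m →
    (D : DyckPath m n) (Υ : Fin m → Fin r) → IsSSPF D Υ → HasWeight w Υ →
    (f : ℤ → ℤ) → IsAw D Υ f →
    (g : ℤ → ℤ) → IsFw m w g →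
    (σ : ℤ → ℤ) → IsAffinePerm m σ → (∀ x → f x ≡ g (σ x)) → OrderCond g σ →
    codinvStd m n σ ≡ pairCount m n f
mainTheorem14 m n r 0<m _ _ _ w sum-w≡m _ _ _ _ f _ g isFw σ _ f≗g∘σ order =
  Standardization.pairCount-std fw-monotone f≗g∘σ order m n
  where open CompositionFw m {{ℕ.>-nonZero 0<m}} w sum-w≡m {g} isFw
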